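{- Let $k$ be an integer with $k\equiv 0\pmod 4$ such that $2k-1$ is a prime power. Write $k-1=ab^2$ with $a,b$ positive integers and $a$ square-free. Suppose there is a divisor $d$ of $ab$ with $d>1$ such that the quadratic form $F(X,Y)=d^2X^2+(2k-1)Y^2$ represents only even powers of $k$ (that is, whenever $F(X,Y)=k^z$ for integers $X,Y$ and a positive integer $z$, $z$ is even). Then the only solution of $x^2+(2k-1)^y=k^z$ in positive integers $x,y,z$ is $(x,y,z)=(k-1,1,2)$. -}

module Defs where

open import Data.Nat using (ℕ; _*_; _^_; _≥_)
open import Data.Nat.Divisibility using (_∣_)
open import Data.Nat.Primality using (Prime)
open import Data.Product using (Σ; _×_)
open import Relation.Binary.PropositionalEquality using (_≡_)

IsPrimePower : ℕ → Set
IsPrimePower n = Σ ℕ λ p → Σ ℕ λ e → Prime p × e ≥ 1 × n ≡ p ^ e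

SquareFree : ℕ → Set
SquareFree a = ∀ m → m * m ∣ a → m ≡ 1

{-# OPTIONS --safe #-}
module Submission where

-- Write k = n + 1 and D = 2k − 1 = p^e. Modulo 4 the right-hand side k^z vanishes, while
-- x² + D^y does not for even y, so y is odd. As D ≡ k ≡ 1 (mod n), n = ab² divides x²; a being
-- square-free, ab and hence d divide x, and x² + D^y = F(x/d, D^((y−1)/2)), so z = 2m is even.
-- Then (k^m − x)(k^m + x) = p^(ey) with p ∤ 2k^m forces k^m = x + 1 and D^y = 2x + 1. For m = 1
-- this is the stated solution and m = 0 is impossible. For m ≥ 2, reading 2k^m = D^y + 1 modulo
-- k² with (2k − 1)^y ≡ 2ky − 1 (mod k²) for odd y gives k ∣ 2y, which 4 ∣ k forbids.

module Integers where
  import Data.Nat as ℕ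
  open import Data.Nat using (ℕ; zero; suc)
  import Data.Nat.Divisibility as ℕ
  open import Data.Nat.Properties using (*-suc; *-comm; ^-*-assoc)
  import Data.Nat.Tactic.RingSolver as ℕ-Solver
  open import Data.Integer using (ℤ; +_; 0ℤ; 1ℤ; _+_; _-_; _*_; _^_; ∣_∣)
  open import Data.Integer.Divisibility.Signed
  open import Data.Integer.Properties using (pos-+; pos-*)
  open import Data.Integer.Tactic.RingSolver using (solve-∀)
  open import Relation.Binary.PropositionalEquality
  open ≡-Reasoning

  pos-^ : ∀ m n → + (m ℕ.^ n) ≡ (+ m) ^ n
  pos-^ m zero    = refl
  pos-^ m (suc n) = trans (pos-* m (m ℕ.^ n)) (cong (+ m *_) (pos-^ m n))

  [2k-1]^y≡2ky-1[mod-k*k] : ∀ k j → let y = 1 ℕ.+ 2 ℕ.* j in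
    k * k ∣ (+ 2 * k - 1ℤ) ^ y + 1ℤ - + 2 * k * + y
  [2k-1]^y≡2ky-1[mod-k*k] k zero = divides 0ℤ (base k)
    where
    base : ∀ k → (+ 2 * k - 1ℤ) * 1ℤ + 1ℤ - + 2 * k * 1ℤ ≡ 0ℤ * (k * k)
    base = solve-∀
  [2k-1]^y≡2ky-1[mod-k*k] k (suc j) =
    subst (λ y → k * k ∣ D ^ y + 1ℤ - + 2 * k * + y) (cong suc (sym (*-suc 2 j)))
      (step (1 ℕ.+ 2 ℕ.* j) ([2k-1]^y≡2ky-1[mod-k*k] k j))
    where
    D = + 2 * k - 1ℤ
    step : ∀ y → k * k ∣ D ^ y + 1ℤ - + 2 * k * + y →
                 k * k ∣ D ^ (2 ℕ.+ y) + 1ℤ - + 2 * k * + (2 ℕ.+ y)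
    step y k*k∣ = subst (k * k ∣_)
      (trans (expand k (D ^ y) (+ y)) (cong (λ Y → D ^ (2 ℕ.+ y) + 1ℤ - + 2 * k * Y) (sym (pos-+ 2 y))))
      (∣m∣n⇒∣m+n (∣n⇒∣m*n (D * D) k*k∣) (∣m⇒∣m*n _ ∣-refl))
      where
      -- D² = 1 + 4k(k − 1), so multiplying by D² moves 2ky to 2k(y + 2) modulo k².
      expand : ∀ k P Y →
        (+ 2 * k - 1ℤ) * (+ 2 * k - 1ℤ) * (P + 1ℤ - + 2 * k * Y) + k * k * (+ 8 * k * Y - + 8 * Y - + 4)
          ≡ (+ 2 * k - 1ℤ) * ((+ 2 * k - 1ℤ) * P) + 1ℤ - + 2 * k * (+ 2 + Y)
      expand = solve-∀

  2k^[2+m]≡[2k-1]^y+1⇒k∣2y : ∀ {k D} m j → .{{ℕ.NonZero k}} → D ℕ.+ 1 ≡ 2 ℕ.* k →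
    let y = 1 ℕ.+ 2 ℕ.* j in D ℕ.^ y ℕ.+ 1 ≡ 2 ℕ.* k ℕ.^ (2 ℕ.+ m) → k ℕ.∣ 2 ℕ.* y
  2k^[2+m]≡[2k-1]^y+1⇒k∣2y {k} {D} m j D+1≡2k D^y+1≡2k^[2+m] =
    subst (k ℕ.∣_) (cong ∣_∣ (sym (pos-* 2 y))) (∣⇒∣ᵤ (*-cancelˡ-∣ K K*K∣K*2y))
    where
    y = 1 ℕ.+ 2 ℕ.* j
    K = + k
    P = (+ 2 * K - 1ℤ) ^ y + 1ℤ
    +D≡2K-1 : + D ≡ + 2 * K - 1ℤ
    +D≡2K-1 = begin
      + D                ≡⟨ i≡i+1-1 (+ D) ⟩
      + D + 1ℤ - 1ℤ      ≡⟨ cong (_- 1ℤ) (pos-+ D 1) ⟨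
      + (D ℕ.+ 1) - 1ℤ   ≡⟨ cong (λ n → + n - 1ℤ) D+1≡2k ⟩
      + (2 ℕ.* k) - 1ℤ   ≡⟨ cong (_- 1ℤ) (pos-* 2 k) ⟩
      + 2 * K - 1ℤ       ∎
      where
      i≡i+1-1 : ∀ i → i ≡ i + 1ℤ - 1ℤ
      i≡i+1-1 = solve-∀
    P≡2k^m*[K*K] : P ≡ + (2 ℕ.* k ℕ.^ m) * (K * K)
    P≡2k^m*[K*K] = begin
      (+ 2 * K - 1ℤ) ^ y + 1ℤ          ≡⟨ cong (λ d → d ^ y + 1ℤ) +D≡2K-1 ⟨
      (+ D) ^ y + 1ℤ                    ≡⟨ cong (_+ 1ℤ) (pos-^ D y) ⟨
      + (D ℕ.^ y) + 1ℤ                  ≡⟨ pos-+ (D ℕ.^ y) 1 ⟨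
      + (D ℕ.^ y ℕ.+ 1)                 ≡⟨ cong +_ D^y+1≡2k^[2+m] ⟩
      + (2 ℕ.* k ℕ.^ (2 ℕ.+ m))         ≡⟨ cong +_ (regroup k (k ℕ.^ m)) ⟩
      + (2 ℕ.* k ℕ.^ m ℕ.* (k ℕ.* k))   ≡⟨ pos-* (2 ℕ.* k ℕ.^ m) (k ℕ.* k) ⟩
      + (2 ℕ.* k ℕ.^ m) * + (k ℕ.* k)   ≡⟨ cong (+ (2 ℕ.* k ℕ.^ m) *_) (pos-* k k) ⟩
      + (2 ℕ.* k ℕ.^ m) * (K * K)       ∎
      where
      regroup : ∀ k q → 2 ℕ.* (k ℕ.* (k ℕ.* q)) ≡ 2 ℕ.* q ℕ.* (k ℕ.* k)
      regroup = ℕ-Solver.solve-∀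
    K*K∣K*2y : K * K ∣ K * (+ 2 * + y)
    K*K∣K*2y = subst (K * K ∣_) (cancel P K (+ y))
      (∣m∣n⇒∣m-n (divides (+ (2 ℕ.* k ℕ.^ m)) P≡2k^m*[K*K]) ([2k-1]^y≡2ky-1[mod-k*k] K j))
      where
      cancel : ∀ P K Y → P - (P - + 2 * K * Y) ≡ K * (+ 2 * Y)
      cancel = solve-∀

  F : ℕ → ℕ → ℤ → ℤ → ℤ
  F d D X Y = + (d ℕ.^ 2) * X ^ 2 + + D * Y ^ 2

  RepresentsOnlyEvenPowers : ℕ → ℕ → ℕ → Set
  RepresentsOnlyEvenPowers d D k = ∀ X Y z → z ℕ.≥ 1 → F d D X Y ≡ + (k ℕ.^ z) → 2 ℕ.∣ z

  F[X,D^j]≡[Xd]^2+D^[1+2j] : ∀ d D X j →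
    F d D (+ X) (+ (D ℕ.^ j)) ≡ + ((X ℕ.* d) ℕ.^ 2 ℕ.+ D ℕ.^ (1 ℕ.+ 2 ℕ.* j))
  F[X,D^j]≡[Xd]^2+D^[1+2j] d D X j = begin
    + (d ℕ.^ 2) * (+ X) ^ 2 + + D * (+ (D ℕ.^ j)) ^ 2
      ≡⟨ cong₂ (λ u v → + (d ℕ.^ 2) * u + + D * v) (pos-^ X 2) (pos-^ (D ℕ.^ j) 2) ⟨
    + (d ℕ.^ 2) * + (X ℕ.^ 2) + + D * + ((D ℕ.^ j) ℕ.^ 2)
      ≡⟨ cong₂ _+_ (pos-* (d ℕ.^ 2) (X ℕ.^ 2)) (pos-* D ((D ℕ.^ j) ℕ.^ 2)) ⟨
    + (d ℕ.^ 2 ℕ.* X ℕ.^ 2) + + (D ℕ.* (D ℕ.^ j) ℕ.^ 2)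
      ≡⟨ pos-+ (d ℕ.^ 2 ℕ.* X ℕ.^ 2) (D ℕ.* (D ℕ.^ j) ℕ.^ 2) ⟨
    + (d ℕ.^ 2 ℕ.* X ℕ.^ 2 ℕ.+ D ℕ.* (D ℕ.^ j) ℕ.^ 2)
      ≡⟨ cong +_ (cong₂ ℕ._+_ (square d X) (cong (D ℕ.*_) D^j^2≡D^2j)) ⟩
    + ((X ℕ.* d) ℕ.^ 2 ℕ.+ D ℕ.^ (1 ℕ.+ 2 ℕ.* j)) ∎
    where
    square : ∀ d X → d ℕ.* (d ℕ.* 1) ℕ.* (X ℕ.* (X ℕ.* 1)) ≡ X ℕ.* d ℕ.* (X ℕ.* d ℕ.* 1)
    square = ℕ-Solver.solve-∀
    D^j^2≡D^2j : (D ℕ.^ j) ℕ.^ 2 ≡ D ℕ.^ (2 ℕ.* j)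
    D^j^2≡D^2j = trans (^-*-assoc D j 2) (cong (D ℕ.^_) (*-comm j 2))

  solution⇒exponent-even : ∀ {d D k} X j z → RepresentsOnlyEvenPowers d D k → z ℕ.≥ 1 →
    (X ℕ.* d) ℕ.^ 2 ℕ.+ D ℕ.^ (1 ℕ.+ 2 ℕ.* j) ≡ k ℕ.^ z → 2 ℕ.∣ z
  solution⇒exponent-even {d} {D} X j z onlyEven z≥1 eq =
    onlyEven (+ X) (+ (D ℕ.^ j)) z z≥1 (trans (F[X,D^j]≡[Xd]^2+D^[1+2j] d D X j) (cong +_ eq))

open import Data.Empty using (⊥-elim)
open import Data.Integer using (ℤ; +_)
import Data.Integer
open import Data.List.Base using (_∷_)
open import Data.List.Relation.Unary.All using (_∷_)
open import Data.Nat
open import Data.Nat.Coprimality using (Coprime; coprime-divisor; GCD≡1⇒coprime)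
open import Data.Nat.Divisibility
open import Data.Nat.GCD using (gcd; GCD; gcd[m,n]∣m; gcd[m,n]∣n; gcd-GCD; GCD-*)
open import Data.Nat.ListAction using (product)
open import Data.Nat.Primality using (Prime; euclidsLemma; prime⇒irreducible; prime⇒nonZero; ¬prime[1])
open import Data.Nat.Primality.Factorisation using (factorise)
open import Data.Nat.Properties
open import Data.Nat.Tactic.RingSolver using (solve-∀)
open import Data.Product using (_×_; _,_; ∃-syntax; map₂)
open import Data.Sum using (_⊎_; inj₁; inj₂; [_,_]′)
open import Function using (id)
open import Relation.Nullary using (¬_; yes; no)
open import Relation.Binary.PropositionalEquality

open import Defs
open Integers

m∣m^n : ∀ m {n} → n ≥ 1 → m ∣ m ^ n
m∣m^n m {suc n} _ = m∣m*n (m ^ n)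

m^n≡m⇒n≡1 : ∀ {m} n → 1 < m → m ^ n ≡ m → n ≡ 1
m^n≡m⇒n≡1 zero          1<m 1≡m   = ⊥-elim (<⇒≢ 1<m 1≡m)
m^n≡m⇒n≡1 1             _   _     = refl
m^n≡m⇒n≡1 {m} (suc (suc n)) 1<m m^n≡m =
  ⊥-elim (<⇒≢ (^-monoʳ-< m 1<m {1} {2 + n} (s≤s (s≤s z≤n))) (trans (*-identityʳ m) (sym m^n≡m)))

p∣m^n⇒p∣m : ∀ {p} m n → Prime p → p ∣ m ^ n → p ∣ m
p∣m^n⇒p∣m m zero    pp p∣1     = ⊥-elim (¬prime[1] (subst Prime (∣1⇒≡1 p∣1) pp))
p∣m^n⇒p∣m m (suc n) pp p∣m^1+n = [ id , p∣m^n⇒p∣m m n pp ]′ (euclidsLemma m (m ^ n) pp p∣m^1+n)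

prime∣prime⇒≡ : ∀ {p q} → Prime p → Prime q → p ∣ q → p ≡ q
prime∣prime⇒≡ pp pq p∣q =
  [ (λ p≡1 → ⊥-elim (¬prime[1] (subst Prime p≡1 pp))) , id ]′ (prime⇒irreducible pq p∣q)

∃prime∣ : ∀ n → n ≥ 2 → ∃[ p ] Prime p × p ∣ n
∃prime∣ 1 (s≤s ())
∃prime∣ n@(suc (suc _)) _ with factorise n
... | record { factors = p ∷ ps ; isFactorisation = n≡p*ps ; factorsPrime = pp ∷ _ } =
  p , pp , subst (p ∣_) (sym n≡p*ps) (m∣m*n (product ps))

∣p^n⇒p∣ : ∀ {p d} n → Prime p → d ≥ 2 → d ∣ p ^ n → p ∣ d
∣p^n⇒p∣ {p} {d} n pp d≥2 d∣p^n with ∃prime∣ d d≥2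
... | r , pr , r∣d = subst (_∣ d) (prime∣prime⇒≡ pr pp (p∣m^n⇒p∣m p n pr (∣-trans r∣d d∣p^n))) r∣d

p∣D⇒p∤2*k^m : ∀ {p D k} m → Prime p → p ∣ D → D + 1 ≡ 2 * k → ¬ p ∣ 2 * k ^ m
p∣D⇒p∤2*k^m {p} {D} {k} m pp p∣D D+1≡2k p∣2k^m = ¬prime[1] (subst Prime (∣1⇒≡1 p∣1) pp)
  where
  p∣2k : p ∣ 2 * k
  p∣2k = [ ∣m⇒∣m*n k , (λ p∣k^m → ∣n⇒∣m*n 2 (p∣m^n⇒p∣m k m pp p∣k^m)) ]′
           (euclidsLemma 2 (k ^ m) pp p∣2k^m)
  p∣1 : p ∣ 1
  p∣1 = ∣m+n∣m⇒∣n (subst (p ∣_) (sym D+1≡2k) p∣2k) p∣D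

record CoprimeSplit (m n : ℕ) : Set where
  field
    g m′ n′  : ℕ
    {{g≢0}}  : NonZero g
    m≡m′*g   : m ≡ m′ * g
    n≡n′*g   : n ≡ n′ * g
    coprime  : Coprime m′ n′

coprimeSplit : ∀ m n → .{{NonZero m}} → CoprimeSplit m n
coprimeSplit m n with gcd m n in g≡gcd | gcd[m,n]∣m m n | gcd[m,n]∣n m n
... | zero      | divides m′ m≡m′*0 | _ = ⊥-elim (≢-nonZero⁻¹ m (trans m≡m′*0 (*-zeroʳ m′)))
... | g@(suc _) | divides m′ m≡m′*g | divides n′ n≡n′*g = record
  { g = g ; m′ = m′ ; n′ = n′ ; m≡m′*g = m≡m′*g ; n≡n′*g = n≡n′*g
  ; coprime = GCD≡1⇒coprime (GCD-* gcd[m′g,n′g]≡1*g) }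
  where
  gcd[m′g,n′g]≡1*g : GCD (m′ * g) (n′ * g) (1 * g)
  gcd[m′g,n′g]≡1*g = subst₂ (λ u v → GCD u v (1 * g)) m≡m′*g n≡n′*g
    (subst (GCD m n) (trans g≡gcd (sym (*-identityˡ g))) (gcd-GCD m n))

m*m∣n*n⇒m∣n : ∀ m n → .{{NonZero m}} → m * m ∣ n * n → m ∣ n
m*m∣n*n⇒m∣n m n m²∣n² with coprimeSplit m n
... | record { g = g ; m′ = m′ ; n′ = n′ ; m≡m′*g = refl ; n≡n′*g = refl ; coprime = m′⊥n′ } =
  subst (λ u → u * g ∣ n′ * g) (sym m′≡1) (*-monoˡ-∣ g (1∣ n′))
  where
  m′²∣n′² : m′ * m′ ∣ n′ * n′
  m′²∣n′² = *-cancelʳ-∣ (g * g) {{m*n≢0 g g}}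
    (subst₂ _∣_ ([m*n]*[o*p]≡[m*o]*[n*p] m′ g m′ g) ([m*n]*[o*p]≡[m*o]*[n*p] n′ g n′ g) m²∣n²)
  m′≡1 : m′ ≡ 1
  m′≡1 = ∣1⇒≡1 (coprime-divisor m′⊥n′ (coprime-divisor m′⊥n′
    (subst (m′ ∣_) (cong (n′ *_) (sym (*-identityʳ n′))) (m*n∣⇒m∣ m′ m′ m′²∣n′²))))

squareFree∣m*m⇒∣m : ∀ {a} m → .{{NonZero a}} → SquareFree a → a ∣ m * m → a ∣ m
squareFree∣m*m⇒∣m {a} m sf a∣m² with coprimeSplit a m
... | record { g = g ; m′ = a′ ; n′ = m′ ; m≡m′*g = refl ; n≡n′*g = refl ; coprime = a′⊥m′ } =
  subst (λ u → u * g ∣ m′ * g) (sym a′≡1) (*-monoˡ-∣ g (1∣ m′))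
  where
  a′∣m′²g : a′ ∣ m′ * (m′ * g)
  a′∣m′²g = *-cancelʳ-∣ g (subst (a′ * g ∣_) (regroup m′ g) a∣m²)
    where regroup : ∀ u v → u * v * (u * v) ≡ u * (u * v) * v
          regroup = solve-∀
  a′≡1 : a′ ≡ 1
  a′≡1 = sf a′ (*-monoʳ-∣ a′ (coprime-divisor a′⊥m′ (coprime-divisor a′⊥m′ a′∣m′²g)))

m^2≡m*m : ∀ m → m ^ 2 ≡ m * m
m^2≡m*m m = cong (m *_) (*-identityʳ m)

a*b^2∣x^2⇒a*b∣x : ∀ {a b} x → .{{NonZero a}} → .{{NonZero b}} →
  SquareFree a → a * b ^ 2 ∣ x ^ 2 → a * b ∣ x
a*b^2∣x^2⇒a*b∣x {a} {b} x sf ab²∣x²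
  with m*m∣n*n⇒m∣n b x (subst₂ _∣_ (m^2≡m*m b) (m^2≡m*m x) (m*n∣⇒n∣ a (b ^ 2) ab²∣x²))
... | divides t refl =
  *-monoˡ-∣ b (squareFree∣m*m⇒∣m t sf (*-cancelʳ-∣ (b * b) {{m*n≢0 b b}} ab²∣t²b²))
  where
  ab²∣t²b² : a * (b * b) ∣ t * t * (b * b)
  ab²∣t²b² = subst₂ _∣_ (cong (a *_) (m^2≡m*m b))
    (trans (m^2≡m*m (t * b)) ([m*n]*[o*p]≡[m*o]*[n*p] t b t b)) ab²∣x²

x^2+c≡[x+q]^2⇒c≡q*[2x+q] : ∀ x q c → x ^ 2 + c ≡ (x + q) ^ 2 → c ≡ q * (2 * x + q)
x^2+c≡[x+q]^2⇒c≡q*[2x+q] x q c eq = +-cancelˡ-≡ (x * x) c (q * (2 * x + q)) (begin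
  x * x + c                ≡⟨ cong (_+ c) (m^2≡m*m x) ⟨
  x ^ 2 + c                ≡⟨ eq ⟩
  (x + q) ^ 2              ≡⟨ m^2≡m*m (x + q) ⟩
  (x + q) * (x + q)        ≡⟨ expand x q ⟩
  x * x + q * (2 * x + q)  ∎)
  where
  open ≡-Reasoning
  expand : ∀ x q → (x + q) * (x + q) ≡ x * x + q * (2 * x + q)
  expand = solve-∀

x^2+p^N≡[x+q]^2⇒q≡1 : ∀ {p} N x q → Prime p → ¬ p ∣ 2 * (x + q) →
  x ^ 2 + p ^ N ≡ (x + q) ^ 2 → q ≡ 1
x^2+p^N≡[x+q]^2⇒q≡1 {p} N x zero pp _ eq =
  ⊥-elim (≢-nonZero⁻¹ (p ^ N) {{m^n≢0 p N {{prime⇒nonZero pp}}}} (x^2+c≡[x+q]^2⇒c≡q*[2x+q] x 0 (p ^ N) eq))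
x^2+p^N≡[x+q]^2⇒q≡1 N x 1 _ _ _ = refl
x^2+p^N≡[x+q]^2⇒q≡1 {p} N x q@(suc (suc _)) pp p∤2[x+q] eq = ⊥-elim (p∤2[x+q] p∣2[x+q])
  where
  p^N≡q*[2x+q] : p ^ N ≡ q * (2 * x + q)
  p^N≡q*[2x+q] = x^2+c≡[x+q]^2⇒c≡q*[2x+q] x q (p ^ N) eq
  p∣q : p ∣ q
  p∣q = ∣p^n⇒p∣ N pp (s≤s (s≤s z≤n)) (divides (2 * x + q) (trans p^N≡q*[2x+q] (*-comm q (2 * x + q))))
  p∣2x+q : p ∣ 2 * x + q
  p∣2x+q = ∣p^n⇒p∣ N pp (≤-trans (s≤s (s≤s z≤n)) (m≤n+m q (2 * x))) (divides q p^N≡q*[2x+q])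
  p∣2[x+q] : p ∣ 2 * (x + q)
  p∣2[x+q] = subst (p ∣_) (regroup x q) (∣m∣n⇒∣m+n p∣q p∣2x+q)
    where regroup : ∀ x q → q + (2 * x + q) ≡ 2 * (x + q)
          regroup = solve-∀

x^2+p^N≡K^2⇒K≡1+x : ∀ {p} N x K → Prime p → ¬ p ∣ 2 * K → x ^ 2 + p ^ N ≡ K ^ 2 →
  K ≡ 1 + x × p ^ N ≡ 1 + 2 * x
x^2+p^N≡K^2⇒K≡1+x {p} N x K pp p∤2K eq with x <? K
... | no x≮K = ⊥-elim (<⇒≱ (m<m+n (x ^ 2) (m^n>0 p {{prime⇒nonZero pp}} N))
                         (subst (_≤ x ^ 2) (sym eq) (^-monoˡ-≤ 2 (≮⇒≥ x≮K))))
... | yes x<K with K ∸ x | m+[n∸m]≡n (<⇒≤ x<K)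
... | q | refl with x^2+p^N≡[x+q]^2⇒q≡1 N x q pp p∤2K eq
... | refl = +-comm x 1 , trans (x^2+c≡[x+q]^2⇒c≡q*[2x+q] x 1 (p ^ N) eq)
                                (trans (*-identityˡ (2 * x + 1)) (+-comm (2 * x) 1))

[1+n*c]^m≡1+n*q : ∀ n c m → ∃[ q ] (1 + n * c) ^ m ≡ 1 + n * q
[1+n*c]^m≡1+n*q n c zero    = 0 , cong suc (sym (*-zeroʳ n))
[1+n*c]^m≡1+n*q n c (suc m) with [1+n*c]^m≡1+n*q n c m
... | q , eq = q + c + n * c * q , trans (cong ((1 + n * c) *_) eq) (expand n c q)
  where
  expand : ∀ n c q → (1 + n * c) * (1 + n * q) ≡ 1 + n * (q + c + n * c * q)
  expand = solve-∀

even⊎odd : ∀ n → ∃[ j ] (n ≡ 2 * j ⊎ n ≡ 1 + 2 * j)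
even⊎odd zero    = 0 , inj₁ refl
even⊎odd (suc n) with even⊎odd n
... | j , inj₁ refl = j , inj₂ refl
... | j , inj₂ refl = suc j , inj₁ (cong suc (sym (+-suc j (j + 0))))

4∤4q+r : ∀ q {r} → 0 < r → r < 4 → ¬ 4 ∣ 4 * q + r
4∤4q+r q {r} 0<r r<4 4∣4q+r = <⇒≱ r<4 (∣⇒≤ {{>-nonZero 0<r}} (∣m+n∣m⇒∣n 4∣4q+r (m∣m*n q)))

4∤m^2+[1+2u]^2 : ∀ m u → ¬ 4 ∣ m ^ 2 + (1 + 2 * u) ^ 2
4∤m^2+[1+2u]^2 m u with even⊎odd m
... | w , inj₁ refl =
  subst (λ s → ¬ 4 ∣ s) (even w u) (4∤4q+r (w * w + u * u + u) (s≤s z≤n) (s≤s (s≤s z≤n)))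
  where
  even : ∀ w u → 4 * (w * w + u * u + u) + 1 ≡ 2 * w * (2 * w * 1) + (1 + 2 * u) * ((1 + 2 * u) * 1)
  even = solve-∀
... | w , inj₂ refl =
  subst (λ s → ¬ 4 ∣ s) (odd w u) (4∤4q+r (w * w + w + u * u + u) (s≤s z≤n) (s≤s (s≤s (s≤s z≤n))))
  where
  odd : ∀ w u → 4 * (w * w + w + u * u + u) + 2
                ≡ (1 + 2 * w) * ((1 + 2 * w) * 1) + (1 + 2 * u) * ((1 + 2 * u) * 1)
  odd = solve-∀

¬4∣2*[1+2j] : ∀ j → ¬ 4 ∣ 2 * (1 + 2 * j)
¬4∣2*[1+2j] j = subst (λ s → ¬ 4 ∣ s) (regroup j) (4∤4q+r j (s≤s z≤n) (s≤s (s≤s (s≤s z≤n))))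
  where regroup : ∀ j → 4 * j + 2 ≡ 2 * (1 + 2 * j)
        regroup = solve-∀

4∣x^2+[1+2u]^y⇒y-odd : ∀ x u y → 4 ∣ x ^ 2 + (1 + 2 * u) ^ y → ∃[ j ] y ≡ 1 + 2 * j
4∣x^2+[1+2u]^y⇒y-odd x u y 4∣x²+D^y with even⊎odd y
... | j , inj₂ y≡1+2j = j , y≡1+2j
... | j , inj₁ refl with [1+n*c]^m≡1+n*q 2 u j
... | v , D^j≡1+2v =
  ⊥-elim (4∤m^2+[1+2u]^2 x v (subst (λ s → 4 ∣ x ^ 2 + s) D^2j≡[1+2v]^2 4∣x²+D^y))
  where
  D^2j≡[1+2v]^2 : (1 + 2 * u) ^ (2 * j) ≡ (1 + 2 * v) ^ 2
  D^2j≡[1+2v]^2 = begin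
    (1 + 2 * u) ^ (2 * j)   ≡⟨ cong ((1 + 2 * u) ^_) (*-comm 2 j) ⟩
    (1 + 2 * u) ^ (j * 2)   ≡⟨ ^-*-assoc (1 + 2 * u) j 2 ⟨
    ((1 + 2 * u) ^ j) ^ 2   ≡⟨ cong (_^ 2) D^j≡1+2v ⟩
    (1 + 2 * v) ^ 2         ∎
    where open ≡-Reasoning

x+[1+2n]^y≡[1+n]^z⇒n∣x : ∀ n x y z → x + (1 + 2 * n) ^ y ≡ suc n ^ z → n ∣ x
x+[1+2n]^y≡[1+n]^z⇒n∣x n x y z eq with [1+n*c]^m≡1+n*q n 2 y | [1+n*c]^m≡1+n*q n 1 z
... | q , D^y≡1+nq | q′ , k^z≡1+nq′ =
  ∣m+n∣m⇒∣n (divides q′ (trans nq+x≡nq′ (*-comm n q′))) (m∣m*n q)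
  where
  nq+x≡nq′ : n * q + x ≡ n * q′
  nq+x≡nq′ = suc-injective (begin
    suc (n * q + x)       ≡⟨ +-comm (1 + n * q) x ⟩
    x + (1 + n * q)       ≡⟨ cong (λ t → x + t) D^y≡1+nq ⟨
    x + (1 + n * 2) ^ y   ≡⟨ cong (λ c → x + (1 + c) ^ y) (*-comm n 2) ⟩
    x + (1 + 2 * n) ^ y   ≡⟨ eq ⟩
    suc n ^ z             ≡⟨ cong (λ c → suc c ^ z) (*-identityʳ n) ⟨
    (1 + n * 1) ^ z       ≡⟨ k^z≡1+nq′ ⟩
    suc (n * q′)          ∎)
    where open ≡-Reasoning

1+2n+1≡2[1+n] : ∀ n → 1 + 2 * n + 1 ≡ 2 * suc n
1+2n+1≡2[1+n] = solve-∀

x^2+D^y≡[k^m]^2⇒k^m≡1+x : ∀ {p e D k} m x y → Prime p → e ≥ 1 → D ≡ p ^ e → D + 1 ≡ 2 * k →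
  x ^ 2 + D ^ y ≡ k ^ (m * 2) → k ^ m ≡ 1 + x × D ^ y ≡ 1 + 2 * x
x^2+D^y≡[k^m]^2⇒k^m≡1+x {p} {e} {D} {k} m x y pp e≥1 refl D+1≡2k eq =
  map₂ (trans (^-*-assoc p e y)) (x^2+p^N≡K^2⇒K≡1+x (e * y) x (k ^ m) pp p∤2k^m eq′)
  where
  p∤2k^m : ¬ p ∣ 2 * k ^ m
  p∤2k^m = p∣D⇒p∤2*k^m m pp (m∣m^n p e≥1) D+1≡2k
  eq′ : x ^ 2 + p ^ (e * y) ≡ (k ^ m) ^ 2
  eq′ = subst₂ (λ u v → x ^ 2 + u ≡ v) (^-*-assoc p e y) (sym (^-*-assoc k m 2)) eq

k^m≡1+x⇒m≡1 : ∀ n m j x → 4 ∣ suc n → x ≥ 1 →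
  suc n ^ m ≡ 1 + x → (1 + 2 * n) ^ (1 + 2 * j) ≡ 1 + 2 * x → x ≡ n × 1 + 2 * j ≡ 1 × m ≡ 1
k^m≡1+x⇒m≡1 n zero j x _ x≥1 1≡1+x _ = ⊥-elim (<⇒≢ x≥1 (suc-injective 1≡1+x))
k^m≡1+x⇒m≡1 n 1 j x 4∣k _ k≡1+x D^y≡1+2x = x≡n , m^n≡m⇒n≡1 (1 + 2 * j) 1<D D^y≡D , refl
  where
  x≡n : x ≡ n
  x≡n = sym (suc-injective (trans (sym (*-identityʳ (suc n))) k≡1+x))
  D^y≡D : (1 + 2 * n) ^ (1 + 2 * j) ≡ 1 + 2 * n
  D^y≡D = subst (λ t → (1 + 2 * n) ^ (1 + 2 * j) ≡ 1 + 2 * t) x≡n D^y≡1+2x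
  n≥1 : n ≥ 1
  n≥1 = ≤-pred (≤-trans (s≤s (s≤s z≤n)) (∣⇒≤ 4∣k))
  1<D : 1 < 1 + 2 * n
  1<D = s≤s (≤-trans n≥1 (m≤m+n n (n + 0)))
k^m≡1+x⇒m≡1 n (suc (suc m)) j x 4∣k _ k^[2+m]≡1+x D^y≡1+2x =
  ⊥-elim (¬4∣2*[1+2j] j (∣-trans 4∣k (2k^[2+m]≡[2k-1]^y+1⇒k∣2y m j (1+2n+1≡2[1+n] n) D^y+1≡2k^[2+m])))
  where
  D^y+1≡2k^[2+m] : (1 + 2 * n) ^ (1 + 2 * j) + 1 ≡ 2 * suc n ^ (2 + m)
  D^y+1≡2k^[2+m] = begin
    (1 + 2 * n) ^ (1 + 2 * j) + 1   ≡⟨ cong (_+ 1) D^y≡1+2x ⟩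
    1 + 2 * x + 1                   ≡⟨ regroup x ⟩
    2 * (1 + x)                     ≡⟨ cong (2 *_) k^[2+m]≡1+x ⟨
    2 * suc n ^ (2 + m)             ∎
    where
    open ≡-Reasoning
    regroup : ∀ x → 1 + 2 * x + 1 ≡ 2 * (1 + x)
    regroup = solve-∀

2*[1+n]∸1≡1+2*n : ∀ n → 2 * suc n ∸ 1 ≡ 1 + 2 * n
2*[1+n]∸1≡1+2*n n = +-suc n (n + 0)

lemma4p3 : (k a b d : ℕ) → 4 ∣ k → IsPrimePower (2 * k ∸ 1) →
    a ≥ 1 → b ≥ 1 → SquareFree a → k ∸ 1 ≡ a * b ^ 2 →
    d ∣ a * b → d > 1 →
    (∀ (X Y : ℤ) (z : ℕ) → z ≥ 1 →
      Data.Integer._+_ (Data.Integer._*_ (+ (d ^ 2)) (Data.Integer._^_ X 2))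
        (Data.Integer._*_ (+ (2 * k ∸ 1)) (Data.Integer._^_ Y 2)) ≡ + (k ^ z) →
      2 ∣ z) →
    ∀ (x y z : ℕ) → x ≥ 1 → y ≥ 1 → z ≥ 1 →
    x ^ 2 + (2 * k ∸ 1) ^ y ≡ k ^ z →
    (x ≡ k ∸ 1) × (y ≡ 1) × (z ≡ 2)
lemma4p3 zero _ _ _ _ (p , e , pp , _ , 0≡p^e) _ _ _ _ _ _ _ _ _ _ _ _ _ _ =
  ⊥-elim (≢-nonZero⁻¹ (p ^ e) {{m^n≢0 p e {{prime⇒nonZero pp}}}} (sym 0≡p^e))
lemma4p3 (suc n) a b d 4∣k (p , e , pp , e≥1 , D≡p^e) a≥1 b≥1 sf n≡ab² d∣ab _ onlyEven x y z x≥1 _ z≥1 eq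
  rewrite 2*[1+n]∸1≡1+2*n n
  with 4∣x^2+[1+2u]^y⇒y-odd x n y (subst (4 ∣_) (sym eq) (∣-trans 4∣k (m∣m^n (suc n) z≥1)))
... | j , refl
  with ∣-trans d∣ab (a*b^2∣x^2⇒a*b∣x x {{>-nonZero a≥1}} {{>-nonZero b≥1}} sf
         (subst (_∣ x ^ 2) n≡ab² (x+[1+2n]^y≡[1+n]^z⇒n∣x n (x ^ 2) y z eq)))
... | divides X refl with solution⇒exponent-even X j z onlyEven z≥1 eq
... | divides m refl
  with x^2+D^y≡[k^m]^2⇒k^m≡1+x m (X * d) (1 + 2 * j) pp e≥1 D≡p^e (1+2n+1≡2[1+n] n) eq
... | k^m≡1+x , D^y≡1+2x with k^m≡1+x⇒m≡1 n m j (X * d) 4∣k x≥1 k^m≡1+x D^y≡1+2x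
... | x≡n , y≡1 , m≡1 = x≡n , y≡1 , cong (_* 2) m≡1
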